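{- Let $\mathcal{F}$ be the M-NAE version of a set $\mathcal{C}$ of 3-literal clauses, and let $N=|U_3|$. Consider a standard truth assignment of $\mathcal{F}$ with a minimum number of true variables. Then: (i) for each $g\in U_2\setminus\{z\}$, at least one of $\alpha_g,\beta_g$ is true; (ii) for each $g\in U_2\setminus\{z\}$, exactly one of $a_g,b_g,c_g$ is true. Consequently, $\frac{2(N-1)}{5}\le t_s(\mathcal{F})\le\frac{2(N-1)}{5}+1$.
   Context: The clauses. Let $X=\{x_1,\dots,x_n\}$ and let $\mathcal{C}=\{C_1,\dots,C_m\}$. Each clause involves three distinct variables and is written $C_r=(l_i\vee l_j\vee l_k)$ with $i<j<k$ and $l_u\in\{x_u,\overline{x_u}\}$. The variables. Let $U_2=\{y_1,\dots,y_n,w_1,\dots,w_m,z\}$ and $U_3=\{z\}\cup\bigcup_{g\in U_2\setminus\{z\}}\{\alpha_g,\beta_g,a_g,b_g,c_g\}$. Then $N=|U_3|=5(n+m)+1$. The M-NAE version $\mathcal{F}$ is the following set of monotone clauses over $U_3$: - for each $C_r=(l_i\vee l_j\vee l_k)$, the clauses $(\gamma_i\vee\gamma_j\vee\alpha_{w_r})$ and $(\beta_{w_r}\vee\gamma_k\vee z)$, where $\gamma_u=\alpha_{y_u}$ if $l_u=x_u$ and $\gamma_u=\beta_{y_u}$ if $l_u=\overline{x_u}$; - for each $g\in U_2\setminus\{z\}$, the clauses $(\alpha_g\vee\beta_g\vee a_g)$, $(\alpha_g\vee\beta_g\vee b_g)$, $(\alpha_g\vee\beta_g\vee c_g)$ and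 $(a_g\vee b_g\vee c_g)$. A standard truth assignment makes every clause contain a true literal. $t_s(\mathcal{F})$ is the minimum number of true variables in a standard truth assignment of $\mathcal{F}$. -}

module Defs where

open import Data.Nat using (ℕ; zero; suc; _+_; _*_; _∸_; _≤_; _<_)
open import Data.Fin using (Fin) renaming (_<_ to _<ᶠ_)
open import Data.Bool using (Bool; true; false; _∨_; if_then_else_)
open import Data.List using (List; []; _∷_; _++_; map; concatMap; allFin; length)
open import Data.Nat.ListAction using (sum)
open import Data.List.Relation.Unary.All using (All)
open import Data.Product using (_×_; _,_; Σ; ∃)
open import Relation.Binary.PropositionalEquality using (_≡_)

-- A literal x_u (sign = true) or ¬x_u (sign = false); a 3-literal clause
-- (l_i ∨ l_j ∨ l_k) on three distinct variables with i < j < k.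
record Clause (n : ℕ) : Set where
  field
    i j k : Fin n
    i<j   : i <ᶠ j
    j<k   : j <ᶠ k
    si sj sk : Bool

-- U₂ \ {z} : the y_u (u ∈ Fin n) and the w_r (r ∈ Fin m)
data G (n m : ℕ) : Set where
  y : Fin n → G n m
  w : Fin m → G n m

data Var (n m : ℕ) : Set where
  z : Var n m
  α β a b c : G n m → Var n m

allG : (n m : ℕ) → List (G n m)
allG n m = map y (allFin n) ++ map w (allFin m)

allVars : (n m : ℕ) → List (Var n m)
allVars n m = z ∷ concatMap (λ g → α g ∷ β g ∷ a g ∷ b g ∷ c g ∷ []) (allG n m)

N : (n m : ℕ) → ℕ
N n m = length (allVars n m)

MClause : ℕ → ℕ → Set
MClause n m = Var n m × Var n m × Var n m

γ : ∀ {n m} → Bool → Fin n → Var n m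
γ true  u = α (y u)
γ false u = β (y u)

clauseClauses : ∀ {n m} → Fin m → Clause n → List (MClause n m)
clauseClauses r C =
  (γ si i , γ sj j , α (w r)) ∷ (β (w r) , γ sk k , z) ∷ []
  where open Clause C

gadget : ∀ {n m} → G n m → List (MClause n m)
gadget g = (α g , β g , a g) ∷ (α g , β g , b g) ∷ (α g , β g , c g) ∷ (a g , b g , c g) ∷ []

MNAE : ∀ {n m} → (Fin m → Clause n) → List (MClause n m)
MNAE {n} {m} 𝓒 = concatMap (λ r → clauseClauses r (𝓒 r)) (allFin m)
                 ++ concatMap gadget (allG n m)

Assignment : ℕ → ℕ → Set
Assignment n m = Var n m → Bool

SatClause : ∀ {n m} → Assignment n m → MClause n m → Set
SatClause σ (u , v , t) = (σ u ∨ σ v ∨ σ t) ≡ true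

Standard : ∀ {n m} → List (MClause n m) → Assignment n m → Set
Standard F σ = All (SatClause σ) F

b2n : Bool → ℕ
b2n true  = 1
b2n false = 0

numTrue : ∀ {n m} → Assignment n m → ℕ
numTrue {n} {m} σ = sum (map (λ v → b2n (σ v)) (allVars n m))

MinStandard : ∀ {n m} → List (MClause n m) → Assignment n m → Set
MinStandard F σ = Standard F σ × (∀ σ' → Standard F σ' → numTrue σ ≤ numTrue σ')

IsTs : ∀ {n m} → List (MClause n m) → ℕ → Set
IsTs F t = (∃ λ σ → Standard F σ × numTrue σ ≡ t) × (∀ σ → Standard F σ → t ≤ numTrue σ)

module Submission where

-- Write p, q, r, s, t for the values of α_g, β_g, a_g, b_g, c_g.
-- The number of true variables splits as [z] + Σ_g weight_g, where weight_g
-- counts the true variables of the gadget of g.  Normalising an assignment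
-- sets α_g := α_g ∨ ¬β_g, a_g := true and b_g, c_g := false in every gadget.
-- It only raises α-variables and keeps β and z, so the clauses coming from 𝓒
-- stay satisfied, and it satisfies every gadget; hence it preserves
-- standardness.  A finite check on five booleans shows that on a satisfied
-- gadget normalisation never increases the weight, that it leaves weight at
-- least 2, and that it keeps the weight only when (i) p ∨ q and (ii)
-- r + s + t = 1 already hold.  For a minimum assignment the total cannot drop,
-- so no gadget weight drops, which gives (i) and (ii).  Finally every
-- standard assignment has weight ≥ 2 in each gadget, while the assignment
-- with exactly the α's, a's and z true is standard with weight 2 in each
-- gadget; since N − 1 = 5·|U₂ \ {z}| this gives 2(N−1)/5 ≤ t_s ≤ 2(N−1)/5 + 1.

open import Defs
open import Data.Nat using (ℕ; _+_; _*_; _∸_; _≤_)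
open import Data.Fin using (Fin)
open import Data.Bool using (Bool; true; _∨_)
open import Data.Product using (_×_)
open import Relation.Binary.PropositionalEquality using (_≡_)

open import Function using (_∘_; id)
open import Data.Nat using (suc; _<_; s≤s; z≤n)
open import Data.Nat.Properties
  using (≤-trans; ≤-antisym; <⇒≱; ≮⇒≥; m≤n+m; +-mono-≤; +-mono-<-≤; +-mono-≤-<;
         +-cancelˡ-≤; *-monoʳ-≤; *-suc; *-zeroʳ; module ≤-Reasoning)
open import Data.Nat.ListAction using (sum)
open import Data.Nat.ListAction.Properties using (sum-++)
open import Data.Nat.Solver using (module +-*-Solver)
open import Data.Bool using (false; not)
open import Data.List using (List; []; _∷_; _++_; map; concatMap; allFin; length)
open import Data.List.Properties using (map-++; map-cong; length-++)
open import Data.List.Relation.Unary.All using (All; []; _∷_; lookup; universal)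
  renaming (map to All-map)
open import Data.List.Relation.Unary.All.Properties using (++⁻; ++⁺; concat⁻; concat⁺; map⁻; map⁺)
open import Data.List.Relation.Unary.Any using (here; there)
open import Data.List.Membership.Propositional using (_∈_)
open import Data.List.Membership.Propositional.Properties using (∈-map⁺; ∈-++⁺ˡ; ∈-++⁺ʳ; ∈-allFin)
open import Data.Product using (_,_; proj₁; proj₂)
open import Relation.Binary.PropositionalEquality
  using (refl; sym; trans; cong; cong₂; subst; subst₂; module ≡-Reasoning)

open +-*-Solver using (solve; _:+_; _:*_; con; _:=_)

All-concatMap⁻ : ∀ {A B : Set} {P : B → Set} (f : A → List B) xs →
  All P (concatMap f xs) → All (All P ∘ f) xs
All-concatMap⁻ f xs = map⁻ ∘ concat⁻

All-concatMap⁺ : ∀ {A B : Set} {P : B → Set} (f : A → List B) xs →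
  All (All P ∘ f) xs → All P (concatMap f xs)
All-concatMap⁺ f xs = concat⁺ ∘ map⁺

module _ {A : Set} where

  sum-map-mono : (f h : A → ℕ) → (∀ x → f x ≤ h x) → ∀ xs → sum (map f xs) ≤ sum (map h xs)
  sum-map-mono f h f≤h []       = z≤n
  sum-map-mono f h f≤h (x ∷ xs) = +-mono-≤ (f≤h x) (sum-map-mono f h f≤h xs)

  sum-map-strict : (f h : A → ℕ) → (∀ x → f x ≤ h x) →
    ∀ {x} xs → x ∈ xs → f x < h x → sum (map f xs) < sum (map h xs)
  sum-map-strict f h f≤h (_ ∷ xs) (here refl) fx<hx = +-mono-<-≤ fx<hx (sum-map-mono f h f≤h xs)
  sum-map-strict f h f≤h (x ∷ xs) (there x∈) fx<hx = +-mono-≤-< (f≤h x) (sum-map-strict f h f≤h xs x∈ fx<hx)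

  sum-map-squeeze : (f h : A → ℕ) → (∀ x → f x ≤ h x) →
    ∀ {x} xs → sum (map h xs) ≤ sum (map f xs) → x ∈ xs → h x ≤ f x
  sum-map-squeeze f h f≤h xs Σh≤Σf x∈ = ≮⇒≥ λ fx<hx → <⇒≱ (sum-map-strict f h f≤h xs x∈ fx<hx) Σh≤Σf

  sum-map-const : ∀ k (xs : List A) → sum (map (λ _ → k) xs) ≡ k * length xs
  sum-map-const k []       = sym (*-zeroʳ k)
  sum-map-const k (x ∷ xs) = trans (cong (k +_) (sum-map-const k xs)) (sym (*-suc k (length xs)))

  sum-map-concatMap : ∀ {B : Set} (f : B → ℕ) (blocks : A → List B) xs →
    sum (map f (concatMap blocks xs)) ≡ sum (map (λ x → sum (map f (blocks x))) xs)
  sum-map-concatMap f blocks []       = refl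
  sum-map-concatMap f blocks (x ∷ xs) = begin
    sum (map f (blocks x ++ concatMap blocks xs))
      ≡⟨ cong sum (map-++ f (blocks x) (concatMap blocks xs)) ⟩
    sum (map f (blocks x) ++ map f (concatMap blocks xs))
      ≡⟨ sum-++ (map f (blocks x)) (map f (concatMap blocks xs)) ⟩
    sum (map f (blocks x)) + sum (map f (concatMap blocks xs))
      ≡⟨ cong (sum (map f (blocks x)) +_) (sum-map-concatMap f blocks xs) ⟩
    sum (map f (blocks x)) + sum (map (λ x → sum (map f (blocks x))) xs) ∎
    where open ≡-Reasoning

  length-concatMap : ∀ {B : Set} (blocks : A → List B) k → (∀ x → length (blocks x) ≡ k) →
    ∀ xs → length (concatMap blocks xs) ≡ k * length xs
  length-concatMap blocks k len []       = sym (*-zeroʳ k)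
  length-concatMap blocks k len (x ∷ xs) = begin
    length (blocks x ++ concatMap blocks xs)          ≡⟨ length-++ (blocks x) ⟩
    length (blocks x) + length (concatMap blocks xs)  ≡⟨ cong₂ _+_ (len x) (length-concatMap blocks k len xs) ⟩
    k + k * length xs                                 ≡⟨ sym (*-suc k (length xs)) ⟩
    k * suc (length xs)                               ∎
    where open ≡-Reasoning

∨-introˡ : ∀ {u} v → u ≡ true → (u ∨ v) ≡ true
∨-introˡ v refl = refl

∨-introʳ : ∀ u {v} → v ≡ true → (u ∨ v) ≡ true
∨-introʳ true  _ = refl
∨-introʳ false e = e

∨₃-raise : ∀ {u v t u′ v′ t′} → (u ≡ true → u′ ≡ true) → (v ≡ true → v′ ≡ true) →
  (t ≡ true → t′ ≡ true) → (u ∨ v ∨ t) ≡ true → (u′ ∨ v′ ∨ t′) ≡ true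
∨₃-raise {true}                                    ru rv rt _ = ∨-introˡ _ (ru refl)
∨₃-raise {false} {true}         {u′ = u′} {t′ = t′} ru rv rt _ = ∨-introʳ u′ (∨-introˡ t′ (rv refl))
∨₃-raise {false} {false} {true} {u′ = u′} {v′ = v′} ru rv rt _ = ∨-introʳ u′ (∨-introʳ v′ (rt refl))
∨₃-raise {false} {false} {false}                   ru rv rt ()

record GadgetSat (p q r s t : Bool) : Set where
  constructor gadgetSat
  field
    αβa : (p ∨ q ∨ r) ≡ true
    αβb : (p ∨ q ∨ s) ≡ true
    αβc : (p ∨ q ∨ t) ≡ true
    abc : (r ∨ s ∨ t) ≡ true

weight : Bool → Bool → Bool → Bool → Bool → ℕ
weight p q r s t = b2n p + b2n q + (b2n r + b2n s + b2n t)

normalWeight : Bool → Bool → ℕ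
normalWeight p q = weight (p ∨ not q) q true false false

normal-clause : ∀ p q u → ((p ∨ not q) ∨ q ∨ u) ≡ true
normal-clause true  q     u = refl
normal-clause false true  u = refl
normal-clause false false u = refl

at-least-one : ∀ r s t → (r ∨ s ∨ t) ≡ true → 1 ≤ b2n r + b2n s + b2n t
at-least-one true  s     t    _ = s≤s z≤n
at-least-one false true  t    _ = s≤s z≤n
at-least-one false false true _ = s≤s z≤n

normalWeight≥2 : ∀ p q → 2 ≤ normalWeight p q
normalWeight≥2 true  true  = s≤s (s≤s z≤n)
normalWeight≥2 true  false = s≤s (s≤s z≤n)
normalWeight≥2 false true  = s≤s (s≤s z≤n)
normalWeight≥2 false false = s≤s (s≤s z≤n)

normalWeight≤weight : ∀ p q r s t → GadgetSat p q r s t → normalWeight p q ≤ weight p q r s t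
normalWeight≤weight true  true  r s t (gadgetSat _ _ _ abc) = s≤s (s≤s (at-least-one r s t abc))
normalWeight≤weight true  false r s t (gadgetSat _ _ _ abc) = s≤s (at-least-one r s t abc)
normalWeight≤weight false true  r s t (gadgetSat _ _ _ abc) = s≤s (at-least-one r s t abc)
normalWeight≤weight false false true  true  true  _                  = s≤s (s≤s z≤n)
normalWeight≤weight false false false _     _     (gadgetSat () _ _ _)
normalWeight≤weight false false true  false _     (gadgetSat _ () _ _)
normalWeight≤weight false false true  true  false (gadgetSat _ _ () _)

weight-tight : ∀ p q r s t → GadgetSat p q r s t → weight p q r s t ≤ normalWeight p q →
  ((p ∨ q) ≡ true) × (b2n r + b2n s + b2n t ≡ 1)
weight-tight true  true  r s t (gadgetSat _ _ _ abc) (s≤s (s≤s k≤1)) = refl , ≤-antisym k≤1 (at-least-one r s t abc)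
weight-tight true  false r s t (gadgetSat _ _ _ abc) (s≤s k≤1)       = refl , ≤-antisym k≤1 (at-least-one r s t abc)
weight-tight false true  r s t (gadgetSat _ _ _ abc) (s≤s k≤1)       = refl , ≤-antisym k≤1 (at-least-one r s t abc)
weight-tight false false true  true  true  _                  (s≤s (s≤s ()))
weight-tight false false false _     _     (gadgetSat () _ _ _) _
weight-tight false false true  false _     (gadgetSat _ () _ _) _
weight-tight false false true  true  false (gadgetSat _ _ () _) _

+-reassoc₅ : ∀ p q r s t → p + (q + (r + (s + (t + 0)))) ≡ p + q + (r + s + t)
+-reassoc₅ = solve 5 (λ p q r s t → p :+ (q :+ (r :+ (s :+ (t :+ con 0)))) := p :+ q :+ (r :+ s :+ t)) refl

scale-bounds : ∀ k t → 2 * k ≤ t → t ≤ suc (2 * k) → (2 * (5 * k) ≤ 5 * t) × (5 * t ≤ 2 * (5 * k) + 5)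
scale-bounds k t lower upper =
  subst (_≤ 5 * t) (swap k) (*-monoʳ-≤ 5 lower) , subst (5 * t ≤_) (expand k) (*-monoʳ-≤ 5 upper)
  where
  swap : ∀ k → 5 * (2 * k) ≡ 2 * (5 * k)
  swap = solve 1 (λ k → con 5 :* (con 2 :* k) := con 2 :* (con 5 :* k)) refl
  expand : ∀ k → 5 * suc (2 * k) ≡ 2 * (5 * k) + 5
  expand = solve 1 (λ k → con 5 :* (con 1 :+ con 2 :* k) := con 2 :* (con 5 :* k) :+ con 5) refl

module _ {n m : ℕ} where

  gadgetVars : G n m → List (Var n m)
  gadgetVars g = α g ∷ β g ∷ a g ∷ b g ∷ c g ∷ []

  gadgetWeight : Assignment n m → G n m → ℕ
  gadgetWeight σ g = weight (σ (α g)) (σ (β g)) (σ (a g)) (σ (b g)) (σ (c g))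

  numTrue-split : ∀ σ → numTrue σ ≡ b2n (σ z) + sum (map (gadgetWeight σ) (allG n m))
  numTrue-split σ = cong (b2n (σ z) +_) (begin
    sum (map (b2n ∘ σ) (concatMap gadgetVars (allG n m)))
      ≡⟨ sum-map-concatMap (b2n ∘ σ) gadgetVars (allG n m) ⟩
    sum (map (λ g → sum (map (b2n ∘ σ) (gadgetVars g))) (allG n m))
      ≡⟨ cong sum (map-cong gadget-sum (allG n m)) ⟩
    sum (map (gadgetWeight σ) (allG n m)) ∎)
    where
    open ≡-Reasoning
    gadget-sum : ∀ g → sum (map (b2n ∘ σ) (gadgetVars g)) ≡ gadgetWeight σ g
    gadget-sum g = +-reassoc₅ (b2n (σ (α g))) (b2n (σ (β g))) (b2n (σ (a g))) (b2n (σ (b g))) (b2n (σ (c g)))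

  N-count : N n m ∸ 1 ≡ 5 * length (allG n m)
  N-count = length-concatMap gadgetVars 5 (λ _ → refl) (allG n m)

  ∈-allG : ∀ g → g ∈ allG n m
  ∈-allG (y u) = ∈-++⁺ˡ (∈-map⁺ y (∈-allFin u))
  ∈-allG (w r) = ∈-++⁺ʳ (map y (allFin n)) (∈-map⁺ w (∈-allFin r))

  module _ (𝓒 : Fin m → Clause n) where

    clausesOf : Fin m → List (MClause n m)
    clausesOf r = clauseClauses r (𝓒 r)

    standard⁻ : ∀ σ → Standard (MNAE 𝓒) σ →
      All (All (SatClause σ) ∘ clausesOf) (allFin m) × All (All (SatClause σ) ∘ gadget) (allG n m)
    standard⁻ σ std =
      let (fromClauses , fromGadgets) = ++⁻ (concatMap clausesOf (allFin m)) std
      in All-concatMap⁻ clausesOf (allFin m) fromClauses , All-concatMap⁻ gadget (allG n m) fromGadgets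

    standard⁺ : ∀ σ → All (All (SatClause σ) ∘ clausesOf) (allFin m) →
      All (All (SatClause σ) ∘ gadget) (allG n m) → Standard (MNAE 𝓒) σ
    standard⁺ σ fromClauses fromGadgets =
      ++⁺ (All-concatMap⁺ clausesOf (allFin m) fromClauses) (All-concatMap⁺ gadget (allG n m) fromGadgets)

    gadget-holds : ∀ σ → Standard (MNAE 𝓒) σ →
      ∀ g → GadgetSat (σ (α g)) (σ (β g)) (σ (a g)) (σ (b g)) (σ (c g))
    gadget-holds σ std g with lookup (proj₂ (standard⁻ σ std)) (∈-allG g)
    ... | h₁ ∷ h₂ ∷ h₃ ∷ h₄ ∷ [] = gadgetSat h₁ h₂ h₃ h₄

  normalise : Assignment n m → Assignment n m
  normalise σ z     = σ z
  normalise σ (α g) = σ (α g) ∨ not (σ (β g))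
  normalise σ (β g) = σ (β g)
  normalise σ (a g) = true
  normalise σ (b g) = false
  normalise σ (c g) = false

  -- Normalisation only raises α's, so it keeps the clauses coming from 𝓒.
  normalise-clauses : ∀ σ r C → All (SatClause σ) (clauseClauses r C) →
    All (SatClause (normalise σ)) (clauseClauses r C)
  normalise-clauses σ r C (h₁ ∷ h₂ ∷ []) =
    ∨₃-raise (raise-γ si i) (raise-γ sj j) (∨-introˡ _) h₁
    ∷ ∨₃-raise {u = σ (β (w r))} {t = σ z} id (raise-γ sk k) id h₂ ∷ []
    where
    open Clause C
    raise-γ : ∀ sign u → σ (γ sign u) ≡ true → normalise σ (γ sign u) ≡ true
    raise-γ true  u = ∨-introˡ _
    raise-γ false u = id

  normalise-gadget : ∀ σ g → All (SatClause (normalise σ)) (gadget g)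
  normalise-gadget σ g = clause true ∷ clause false ∷ clause false ∷ refl ∷ []
    where clause = normal-clause (σ (α g)) (σ (β g))

  normalise-standard : ∀ 𝓒 σ → Standard (MNAE 𝓒) σ → Standard (MNAE 𝓒) (normalise σ)
  normalise-standard 𝓒 σ std = standard⁺ 𝓒 (normalise σ)
    (All-map (λ {r} → normalise-clauses σ r (𝓒 r)) (proj₁ (standard⁻ 𝓒 σ std)))
    (universal (normalise-gadget σ) (allG n m))

  -- Parts (i) and (ii): in a minimum assignment no gadget can be lightened.
  minimum-gadgets : ∀ 𝓒 σ → MinStandard (MNAE 𝓒) σ → ∀ g →
    ((σ (α g) ∨ σ (β g)) ≡ true) × (b2n (σ (a g)) + b2n (σ (b g)) + b2n (σ (c g)) ≡ 1)
  minimum-gadgets 𝓒 σ (std , minimum) g =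
    weight-tight _ _ _ _ _ (gadget-holds 𝓒 σ std g)
      (sum-map-squeeze (gadgetWeight (normalise σ)) (gadgetWeight σ) lighter (allG n m) no-lighter (∈-allG g))
    where
    lighter : ∀ h → gadgetWeight (normalise σ) h ≤ gadgetWeight σ h
    lighter h = normalWeight≤weight _ _ _ _ _ (gadget-holds 𝓒 σ std h)
    no-lighter : sum (map (gadgetWeight σ) (allG n m)) ≤ sum (map (gadgetWeight (normalise σ)) (allG n m))
    no-lighter = +-cancelˡ-≤ (b2n (σ z)) _ _
      (subst₂ _≤_ (numTrue-split σ) (numTrue-split (normalise σ))
        (minimum (normalise σ) (normalise-standard 𝓒 σ std)))

  -- Lower bound: each gadget of a standard assignment has weight ≥ 2.
  standard-lower : ∀ 𝓒 σ → Standard (MNAE 𝓒) σ → 2 * length (allG n m) ≤ numTrue σ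
  standard-lower 𝓒 σ std = begin
    2 * length (allG n m)                                ≡⟨ sum-map-const 2 (allG n m) ⟨
    sum (map (λ _ → 2) (allG n m))                       ≤⟨ sum-map-mono _ _ heavy (allG n m) ⟩
    sum (map (gadgetWeight σ) (allG n m))                ≤⟨ m≤n+m _ (b2n (σ z)) ⟩
    b2n (σ z) + sum (map (gadgetWeight σ) (allG n m))    ≡⟨ numTrue-split σ ⟨
    numTrue σ                                            ∎
    where
    open ≤-Reasoning
    heavy : ∀ g → 2 ≤ gadgetWeight σ g
    heavy g = ≤-trans (normalWeight≥2 (σ (α g)) (σ (β g))) (normalWeight≤weight _ _ _ _ _ (gadget-holds 𝓒 σ std g))

  canonical : Assignment n m
  canonical z     = true
  canonical (α _) = true
  canonical (β _) = false
  canonical (a _) = true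
  canonical (b _) = false
  canonical (c _) = false

  canonical-standard : ∀ 𝓒 → Standard (MNAE 𝓒) canonical
  canonical-standard 𝓒 = standard⁺ 𝓒 canonical
    (universal clauses (allFin m)) (universal (λ _ → refl ∷ refl ∷ refl ∷ refl ∷ []) (allG n m))
    where
    -- α_{w_r} makes the first clause of C_r true and z the second one.
    clauses : ∀ r → All (SatClause canonical) (clausesOf 𝓒 r)
    clauses r = ∨-introʳ (canonical (γ si i)) (∨-introʳ (canonical (γ sj j)) refl)
              ∷ ∨-introʳ (canonical (γ sk k)) refl ∷ []
      where open Clause (𝓒 r)

  canonical-count : numTrue canonical ≡ suc (2 * length (allG n m))
  canonical-count = begin
    numTrue canonical                             ≡⟨ numTrue-split canonical ⟩
    suc (sum (map (gadgetWeight canonical) (allG n m)))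
      ≡⟨ cong (suc ∘ sum) (map-cong (λ _ → refl) (allG n m)) ⟩
    suc (sum (map (λ _ → 2) (allG n m)))          ≡⟨ cong suc (sum-map-const 2 (allG n m)) ⟩
    suc (2 * length (allG n m))                   ∎
    where open ≡-Reasoning

claim4 : (n m : ℕ) (𝓒 : Fin m → Clause n) →
    ((σ : Assignment n m) → MinStandard (MNAE 𝓒) σ →
      (g : G n m) →
        ((σ (α g) ∨ σ (β g)) ≡ true)
        × (b2n (σ (a g)) + b2n (σ (b g)) + b2n (σ (c g)) ≡ 1))
    × ((t : ℕ) → IsTs (MNAE 𝓒) t →
        (2 * (N n m ∸ 1) ≤ 5 * t) × (5 * t ≤ 2 * (N n m ∸ 1) + 5))
claim4 n m 𝓒 = minimum-gadgets 𝓒 , ts-bounds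
  where
  ts-bounds : (t : ℕ) → IsTs (MNAE 𝓒) t →
    (2 * (N n m ∸ 1) ≤ 5 * t) × (5 * t ≤ 2 * (N n m ∸ 1) + 5)
  ts-bounds _ ((σ , std , refl) , minimum) =
    subst (λ k → (2 * k ≤ 5 * numTrue σ) × (5 * numTrue σ ≤ 2 * k + 5)) (sym (N-count {n} {m}))
      (scale-bounds (length (allG n m)) (numTrue σ) (standard-lower 𝓒 σ std)
        (subst (numTrue σ ≤_) (canonical-count {n} {m}) (minimum canonical (canonical-standard 𝓒))))
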